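{- Let $v$ and $k$ be positive integers with $v\not\equiv 2\pmod 4$ and $k\ge 3$. Then there exists an AOA$(1,k-1,k,v)$.
   Context: An orthogonal array OA$(t,k,v)$ is a $v^t\times k$ array with entries from a set $X$ of size $v$ such that the restriction to any $t$ columns contains every $t$-tuple of $X^t$ exactly once. An AOA$(s,t,k,v)$ is a $v^t\times (k+1)$ array $A$ such that: (1) the first $k$ columns form an OA$(t,k,v)$ on a set $X$ with $|X|=v$; (2) the last column has symbols from a set $Y$ with $|Y|=v^{t-s}$; (3) any $s$ of the first $k$ columns together with the last column contain every $(s+1)$-tuple of $X^s\times Y$ exactly once. -}

module Defs where

open import Data.Nat using (ℕ; _^_; _∸_)
open import Data.Fin using (Fin)
open import Data.Product using (Σ; _×_; ∃)
open import Relation.Binary.PropositionalEquality using (_≡_)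
open import Function.Definitions using (Injective)

ExactlyOne : {N : ℕ} → (Fin N → Set) → Set
ExactlyOne {N} P = Σ (Fin N) λ r → P r × (∀ r′ → P r′ → r′ ≡ r)

Array : ℕ → ℕ → ℕ → Set
Array N k v = Fin N → Fin k → Fin v

IsOA : (t k v : ℕ) → Array (v ^ t) k v → Set
IsOA t k v A =
  (c : Fin t → Fin k) → Injective _≡_ _≡_ c →
  (x : Fin t → Fin v) →
  ExactlyOne (λ r → ∀ j → A r (c j) ≡ x j)

-- AOA(s,t,k,v): a v^t × (k+1) array; first k columns A over X = Fin v,
-- last column L over Y = Fin (v^(t-s)).
record AOA (s t k v : ℕ) : Set where
  field
    A : Array (v ^ t) k v
    L : Fin (v ^ t) → Fin (v ^ (t ∸ s))
    isOA : IsOA t k v A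
    augmented :
      (c : Fin s → Fin k) → Injective _≡_ _≡_ c →
      (x : Fin s → Fin v) → (y : Fin (v ^ (t ∸ s))) →
      ExactlyOne (λ r → (∀ j → A r (c j) ≡ x j) × L r ≡ y)

-- A row is a word u = (u₀, …, u_{k-2}) over an abelian group G of order v. Its first k
-- entries are u preceded by (∏ u)⁻¹; they multiply to ε, so any k-1 of them determine the
-- rest, which gives the OA. Its last entry is the word (u₁ θ(u₀)⁻¹, u₂ θ(u₀), u₃ θ(u₀)⁻¹, …)
-- for a complete mapping θ of G. Given this word, u is determined by u₀, and any one entry
-- recovers u₀: directly, through θ, or, from the first entry, through u₀ ↦ u₀ ∏ᵢ θ(u₀)^(±1),
-- which is u₀ ↦ u₀ or u₀ ↦ u₀ θ(u₀) because the signs alternate; both are injective. In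
-- every case reading the prescribed entries is an injective map on the v^(k-1) rows, hence a
-- bijection, which is the "exactly once". Complete mappings exist for v ≢ 2 (mod 4): θ = id
-- on ℤ/v for odd v, multiplication by a primitive element on GF(4) and GF(8), and products.
module Submission where

open import Defs
open import Level using (0ℓ)
open import Algebra.Bundles using (AbelianGroup; RawGroup)
open import Algebra.Core using (Op₁; Op₂)
open import Algebra.Structures using (IsAbelianGroup)
open import Algebra.Morphism.Structures using (IsGroupMonomorphism)
open import Algebra.Consequences.Propositional using (comm∧idˡ⇒id; comm∧invˡ⇒inv)
import Algebra.Construct.DirectProduct as DirectProduct
import Algebra.Construct.Subst.Equality as SubstEquality
import Algebra.Morphism.GroupMonomorphism as GroupMonomorphism
import Algebra.Properties.AbelianGroup as AbelianGroupProperties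
import Algebra.Properties.CommutativeMonoid.Sum as Sum
import Algebra.Properties.CommutativeSemigroup as CommutativeSemigroupProperties
open import Data.Nat using (ℕ; zero; suc; _+_; _*_; _∸_; _^_; _%_; _≤_; _<_; s≤s; z≤n; NonZero)
open import Data.Nat.DivMod
  using (_mod_; %-distribˡ-+; %-distribˡ-*; m%n%n≡m%n; n%n≡0; [m+kn]%n≡m%n; m<n⇒m%n≡m)
open import Data.Nat.Induction using (<-rec)
open import Data.Nat.Properties using (1+n≰n; +-comm; +-assoc; m<m*n; m∸n+n≡m; <⇒≤)
open import Data.Nat.Tactic.RingSolver using (solve-∀)
open import Data.Fin
  using (Fin; zero; suc; toℕ; punchIn; punchOut; combine; finToFun; funToFin; #_; _≟_)
open import Data.Fin.Properties
  using (any?; all?; ¬∀⟶∃¬; injective⇒≤; punchOut-injective; punchIn-punchOut; combine-injective;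
         finToFun-funToFin; funToFin-finToFin; toℕ-fromℕ<; toℕ-injective; toℕ<n; *↔×)
open import Data.Product using (∃; _×_; _,_; proj₁; proj₂)
import Data.Product as Product
open import Data.Product.Properties using (×-≡,≡→≡; ×-≡,≡←≡)
open import Data.Product.Relation.Binary.Pointwise.NonDependent using (≡×≡⇒≡; ≡⇒≡×≡)
open import Data.Sum using (_⊎_; inj₁; inj₂)
open import Data.Vec.Functional using ([]; _∷_; removeAt)
open import Function using (id; _∘_; _↔_; Inverse)
open import Function.Bundles using (Injection)
open import Function.Definitions using (Injective)
open import Function.Properties.Inverse using (Inverse⇒Injection; ↔-sym)
open import Relation.Nullary using (Dec; yes; no; ¬_; contradiction)
open import Relation.Nullary.Decidable using (map′; _→-dec_; from-yes)
open import Relation.Binary.PropositionalEquality hiding ([_])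
open ≡-Reasoning

injective⇒surjective : ∀ {n} (f : Fin n → Fin n) → Injective _≡_ _≡_ f →
                       ∀ y → ∃ λ x → f x ≡ y
injective⇒surjective {suc n} f f-inj y with any? (λ x → f x ≟ y)
... | yes hit = hit
... | no miss = contradiction (injective⇒≤ g-inj) 1+n≰n
  where
  y≢f : ∀ x → y ≢ f x
  y≢f x eq = miss (x , sym eq)
  g-inj : Injective _≡_ _≡_ (λ x → punchOut (y≢f x))
  g-inj = f-inj ∘ punchOut-injective (y≢f _) (y≢f _)

¬surjective : ∀ {m} (c : Fin m → Fin (suc m)) → ¬ (∀ y → ∃ λ x → c x ≡ y)
¬surjective c surj = 1+n≰n (injective⇒≤ {f = proj₁ ∘ surj} λ {y} {y′} eq →
  trans (sym (proj₂ (surj y))) (trans (cong c eq) (proj₂ (surj y′))))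

injective⇒missesOne : ∀ {m} (c : Fin m → Fin (suc m)) → Injective _≡_ _≡_ c →
                      ∃ λ p → ∀ j → ∃ λ i → c i ≡ punchIn p j
injective⇒missesOne {m} c c-inj with ¬∀⟶∃¬ (suc m) _ (λ y → any? (λ x → c x ≟ y)) (¬surjective c)
... | p , p-missed = p , hits
  where
  p≢c : ∀ i → p ≢ c i
  p≢c i eq = p-missed (i , sym eq)
  hits : ∀ j → ∃ λ i → c i ≡ punchIn p j
  hits j with injective⇒surjective (λ i → punchOut (p≢c i))
                (c-inj ∘ punchOut-injective (p≢c _) (p≢c _)) j
  ... | i , eq = i , trans (sym (punchIn-punchOut (p≢c i))) (cong (punchIn p) eq)

injective-≗ : ∀ {a b} {A : Set a} {B : Set b} {f g : A → B} →
              f ≗ g → Injective _≡_ _≡_ g → Injective _≡_ _≡_ f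
injective-≗ f≗g g-inj {x} {y} eq = g-inj (trans (sym (f≗g x)) (trans eq (f≗g y)))

injective? : ∀ {m n} (f : Fin m → Fin n) → Dec (Injective _≡_ _≡_ f)
injective? f = map′ (λ inj {x} {y} → inj x y) (λ inj x y → inj)
                    (all? λ x → all? λ y → (f x ≟ f y) →-dec (x ≟ y))

≗-punchIn : ∀ {a} {A : Set a} {n} {w w′ : Fin (suc n) → A} (p : Fin (suc n)) →
            w p ≡ w′ p → (∀ j → w (punchIn p j) ≡ w′ (punchIn p j)) → w ≗ w′
≗-punchIn {w = w} {w′} p agree-p agree-else i with i ≟ p
... | yes refl = agree-p
... | no i≢p = subst (λ i → w i ≡ w′ i) (punchIn-punchOut p≢i) (agree-else (punchOut p≢i))
  where
  p≢i : p ≢ i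
  p≢i = i≢p ∘ sym

exactlyOne-fiber : ∀ {n} (f : Fin n → Fin n) → Injective _≡_ _≡_ f →
                   ∀ y → ExactlyOne (λ x → f x ≡ y)
exactlyOne-fiber f f-inj y with injective⇒surjective f f-inj y
... | x , fx≡y = x , fx≡y , λ x′ fx′≡y → f-inj (trans fx′≡y (sym fx≡y))

exactlyOne-⇔ : ∀ {n} {P Q : Fin n → Set} → (∀ {x} → P x → Q x) → (∀ {x} → Q x → P x) →
               ExactlyOne P → ExactlyOne Q
exactlyOne-⇔ P⇒Q Q⇒P (x , Px , unique) = x , P⇒Q Px , λ x′ → unique x′ ∘ Q⇒P

funToFin-cong : ∀ {m n} {f g : Fin m → Fin n} → f ≗ g → funToFin f ≡ funToFin g
funToFin-cong {zero}  f≗g = refl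
funToFin-cong {suc m} f≗g = cong₂ combine (f≗g zero) (funToFin-cong (f≗g ∘ suc))

funToFin-injective : ∀ {m n} {f g : Fin m → Fin n} → funToFin f ≡ funToFin g → f ≗ g
funToFin-injective {f = f} {g} eq i =
  trans (sym (finToFun-funToFin f i)) (trans (cong (λ r → finToFun r i) eq) (finToFun-funToFin g i))

finToFun-injective : ∀ {m n} {r r′ : Fin (m ^ n)} → finToFun {m} {n} r ≗ finToFun r′ → r ≡ r′
finToFun-injective {m} {n} {r} {r′} eq =
  trans (sym (funToFin-finToFin {n} {m} r))
        (trans (funToFin-cong eq) (funToFin-finToFin {n} {m} r′))

-- Arrays from codes

IsMDS : ∀ {A : Set} {t k} → ((Fin t → A) → Fin k → A) → Set
IsMDS {t = t} {k} E = ∀ (c : Fin t → Fin k) → Injective _≡_ _≡_ c →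
                      ∀ u u′ → (∀ j → E u (c j) ≡ E u′ (c j)) → u ≗ u′

IsAugmentingLabel : ∀ {A : Set} {t k l} →
                    ((Fin t → A) → Fin k → A) → ((Fin t → A) → Fin l → A) → Set
IsAugmentingLabel {k = k} E ℓ = ∀ (col : Fin k) u u′ → E u col ≡ E u′ col → ℓ u ≗ ℓ u′ → u ≗ u′

codeArray : ∀ {t k v} → ((Fin t → Fin v) → Fin k → Fin v) → Array (v ^ t) k v
codeArray E r = E (finToFun r)

codeLabel : ∀ {t l v} → ((Fin t → Fin v) → Fin l → Fin v) → Fin (v ^ t) → Fin (v ^ l)
codeLabel ℓ r = funToFin (ℓ (finToFun r))

isOA-codeArray : ∀ {t k v} (E : (Fin t → Fin v) → Fin k → Fin v) → IsMDS E →
                 IsOA t k v (codeArray E)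
isOA-codeArray {t} {k} {v} E mds c c-inj x =
  exactlyOne-⇔ funToFin-injective funToFin-cong (exactlyOne-fiber read read-inj (funToFin x))
  where
  read : Fin (v ^ t) → Fin (v ^ t)
  read r = funToFin (λ j → codeArray E r (c j))
  read-inj : Injective _≡_ _≡_ read
  read-inj = finToFun-injective ∘ mds c c-inj _ _ ∘ funToFin-injective

augmented-codeArray : ∀ {n k v} (E : (Fin (suc n) → Fin v) → Fin k → Fin v)
                      (ℓ : (Fin (suc n) → Fin v) → Fin n → Fin v) → IsAugmentingLabel E ℓ →
                      (c : Fin 1 → Fin k) (x : Fin 1 → Fin v) (y : Fin (v ^ n)) →
                      ExactlyOne (λ r → (∀ j → codeArray E r (c j) ≡ x j) × codeLabel ℓ r ≡ y)
augmented-codeArray {n} {k} {v} E ℓ augmenting c x y =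
  exactlyOne-⇔ split join (exactlyOne-fiber read read-inj (combine (x zero) y))
  where
  read : Fin (v ^ suc n) → Fin (v ^ suc n)
  read r = combine (codeArray E r (c zero)) (codeLabel ℓ r)
  read-inj : Injective _≡_ _≡_ read
  read-inj eq with combine-injective _ _ _ _ eq
  ... | entry≡ , label≡ =
    finToFun-injective (augmenting (c zero) _ _ entry≡ (funToFin-injective label≡))
  split : ∀ {r} → read r ≡ combine (x zero) y →
          (∀ j → codeArray E r (c j) ≡ x j) × codeLabel ℓ r ≡ y
  split eq with combine-injective _ _ _ _ eq
  ... | entry≡ , label≡ = (λ { zero → entry≡ }) , label≡
  join : ∀ {r} → (∀ j → codeArray E r (c j) ≡ x j) × codeLabel ℓ r ≡ y →
         read r ≡ combine (x zero) y
  join (entries≡ , label≡) = cong₂ combine (entries≡ zero) label≡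

aoa-fromCode : ∀ {n k v} (E : (Fin (suc n) → Fin v) → Fin k → Fin v)
               (ℓ : (Fin (suc n) → Fin v) → Fin n → Fin v) →
               IsMDS E → IsAugmentingLabel E ℓ → AOA 1 (suc n) k v
aoa-fromCode E ℓ mds augmenting = record
  { A = codeArray E
  ; L = codeLabel ℓ
  ; isOA = isOA-codeArray E mds
  ; augmented = λ c _ → augmented-codeArray E ℓ augmenting c
  }

-- Abelian groups and complete mappings

record AbelianGroupOn (A : Set) : Set where
  infixl 7 _∙_
  infix  8 _⁻¹
  field
    _∙_ : Op₂ A
    ε   : A
    _⁻¹ : Op₁ A
    isAbelianGroup : IsAbelianGroup _≡_ _∙_ ε _⁻¹

  abelianGroup : AbelianGroup 0ℓ 0ℓ
  abelianGroup = record { isAbelianGroup = isAbelianGroup }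

  rawGroup : RawGroup 0ℓ 0ℓ
  rawGroup = AbelianGroup.rawGroup abelianGroup

_×ᴳ_ : ∀ {A B} → AbelianGroupOn A → AbelianGroupOn B → AbelianGroupOn (A × B)
G ×ᴳ H = record
  { _∙_ = _∙_
  ; ε   = ε
  ; _⁻¹ = _⁻¹
  ; isAbelianGroup = SubstEquality.isAbelianGroup (≡×≡⇒≡ , ≡⇒≡×≡) isAbelianGroup
  }
  where
  open AbelianGroup (DirectProduct.abelianGroup (AbelianGroupOn.abelianGroup G)
                                                (AbelianGroupOn.abelianGroup H))

transportᴳ : ∀ {A B} → A ↔ B → AbelianGroupOn B → AbelianGroupOn A
transportᴳ e G = record
  { _∙_ = raw._∙_
  ; ε   = raw.ε
  ; _⁻¹ = raw._⁻¹
  ; isAbelianGroup = GroupMonomorphism.isAbelianGroup to-isMonomorphism G.isAbelianGroup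
  }
  where
  module G = AbelianGroupOn G
  open Inverse e
  raw : RawGroup 0ℓ 0ℓ
  raw = record
    { _≈_ = _≡_ ; _∙_ = λ x y → from (to x G.∙ to y) ; ε = from G.ε ; _⁻¹ = λ x → from (to x G.⁻¹) }
  module raw = RawGroup raw
  to-isMonomorphism : IsGroupMonomorphism raw G.rawGroup to
  to-isMonomorphism = record
    { isGroupHomomorphism = record
      { isMonoidHomomorphism = record
        { isMagmaHomomorphism = record
          { isRelHomomorphism = record { cong = cong to }
          ; homo = λ x y → strictlyInverseˡ (to x G.∙ to y)
          }
        ; ε-homo = strictlyInverseˡ G.ε
        }
      ; ⁻¹-homo = λ x → strictlyInverseˡ (to x G.⁻¹)
      }
    ; injective = Injection.injective (Inverse⇒Injection e)
    }

-- Only injectivity is required; on a finite group it makes θ and x ↦ x ∙ θ x bijections.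
record CompleteMapping (A : Set) : Set where
  field
    group : AbelianGroupOn A
  open AbelianGroupOn group public
  field
    θ : A → A
    θ-injective : Injective _≡_ _≡_ θ
    id∙θ-injective : Injective _≡_ _≡_ (λ x → x ∙ θ x)

_×ᶜ_ : ∀ {A B} → CompleteMapping A → CompleteMapping B → CompleteMapping (A × B)
M ×ᶜ N = record
  { group = M.group ×ᴳ N.group
  ; θ = Product.map M.θ N.θ
  ; θ-injective = ×-≡,≡→≡ ∘ Product.map M.θ-injective N.θ-injective ∘ ×-≡,≡←≡
  ; id∙θ-injective = ×-≡,≡→≡ ∘ Product.map M.id∙θ-injective N.id∙θ-injective ∘ ×-≡,≡←≡
  }
  where
  module M = CompleteMapping M
  module N = CompleteMapping N

transport : ∀ {A B} → A ↔ B → CompleteMapping B → CompleteMapping A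
transport e M = record
  { group = transportᴳ e M.group
  ; θ = from ∘ M.θ ∘ to
  ; θ-injective = to-injective ∘ M.θ-injective ∘ from-injective
  ; id∙θ-injective = λ {x} {y} eq → to-injective (M.id∙θ-injective (begin
      to x M.∙ M.θ (to x)             ≡⟨ cong (to x M.∙_) (strictlyInverseˡ _) ⟨
      to x M.∙ to (from (M.θ (to x))) ≡⟨ from-injective eq ⟩
      to y M.∙ to (from (M.θ (to y))) ≡⟨ cong (to y M.∙_) (strictlyInverseˡ _) ⟩
      to y M.∙ M.θ (to y)             ∎))
  }
  where
  module M = CompleteMapping M
  open Inverse e
  to-injective : Injective _≡_ _≡_ to
  to-injective = Injection.injective (Inverse⇒Injection e)
  from-injective : Injective _≡_ _≡_ from
  from-injective = Injection.injective (Inverse⇒Injection (↔-sym e))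

_⊗_ : ∀ {m n} → CompleteMapping (Fin m) → CompleteMapping (Fin n) → CompleteMapping (Fin (m * n))
M ⊗ N = transport *↔× (M ×ᶜ N)

-- The zero-sum code and its label

module ZeroSumCode {A : Set} (M : CompleteMapping A) where
  open CompleteMapping M
  open AbelianGroup abelianGroup
    using (inverseˡ; inverseʳ; identityʳ; commutativeMonoid; commutativeSemigroup)
  open AbelianGroupProperties abelianGroup
  open Sum commutativeMonoid using (sum; sum-syntax; sum-remove; sum-cong-≗; ∑-distrib-+)
  open CommutativeSemigroupProperties commutativeSemigroup using (x∙yz≈y∙xz)

  sum-determines : ∀ {n} (w w′ : Fin (suc n) → A) (p : Fin (suc n)) → sum w ≡ sum w′ →
                   (∀ j → w (punchIn p j) ≡ w′ (punchIn p j)) → w ≗ w′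
  sum-determines w w′ p sums≡ agree = ≗-punchIn p (∙-cancelʳ _ _ _ (begin
    w p ∙ sum (removeAt w p)    ≡⟨ sum-remove w ⟨
    sum w                       ≡⟨ sums≡ ⟩
    sum w′                      ≡⟨ sum-remove w′ ⟩
    w′ p ∙ sum (removeAt w′ p)  ≡⟨ cong (w′ p ∙_) (sum-cong-≗ agree) ⟨
    w′ p ∙ sum (removeAt w p)   ∎)) agree

  zeroSumWord : ∀ {n} → (Fin (suc n) → A) → Fin (suc (suc n)) → A
  zeroSumWord u = sum u ⁻¹ ∷ u

  zeroSumWord-isMDS : ∀ {n} → IsMDS (zeroSumWord {n})
  zeroSumWord-isMDS c c-inj u u′ agree-c with injective⇒missesOne c c-inj
  ... | p , hits = words≗ ∘ suc
    where
    agree : ∀ j → zeroSumWord u (punchIn p j) ≡ zeroSumWord u′ (punchIn p j)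
    agree j with hits j
    ... | i , ci≡ = subst (λ col → zeroSumWord u col ≡ zeroSumWord u′ col) ci≡ (agree-c i)
    words≗ : zeroSumWord u ≗ zeroSumWord u′
    words≗ = sum-determines _ _ p (trans (inverseˡ (sum u)) (sym (inverseˡ (sum u′)))) agree

  alternate : ℕ → A → A
  alternate zero    x = x
  alternate (suc i) x = alternate i x ⁻¹

  alternate-injective : ∀ i → Injective _≡_ _≡_ (alternate i)
  alternate-injective zero    = id
  alternate-injective (suc i) = alternate-injective i ∘ ⁻¹-injective

  sum-⁻¹ : ∀ {n} (f : Fin n → A) → ∑[ i < n ] (f i ⁻¹) ≡ sum f ⁻¹
  sum-⁻¹ {zero}  f = sym ε⁻¹≈ε
  sum-⁻¹ {suc n} f = trans (cong (f zero ⁻¹ ∙_) (sum-⁻¹ (f ∘ suc))) (⁻¹-∙-comm _ _)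

  sum-alternate : ∀ n → (∀ x → ∑[ i < n ] alternate (toℕ i) x ≡ ε)
                      ⊎ (∀ x → ∑[ i < n ] alternate (toℕ i) x ≡ x)
  sum-alternate zero = inj₁ λ _ → refl
  sum-alternate (suc n) with sum-alternate n
  ... | inj₁ ≡ε = inj₂ λ x → trans (cong (x ∙_) (trans (sum-⁻¹ {n} (λ i → alternate (toℕ i) x))
                                                        (trans (cong _⁻¹ (≡ε x)) ε⁻¹≈ε)))
                                   (identityʳ x)
  ... | inj₂ ≡x = inj₁ λ x → trans (cong (x ∙_) (trans (sum-⁻¹ {n} (λ i → alternate (toℕ i) x))
                                                        (cong _⁻¹ (≡x x))))
                                   (inverseʳ x)

  alternatingθ : ℕ → A → A
  alternatingθ n x = ∑[ i < n ] alternate (toℕ i) (θ x)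

  id∙alternatingθ-injective : ∀ n → Injective _≡_ _≡_ (λ x → x ∙ alternatingθ n x)
  id∙alternatingθ-injective n with sum-alternate n
  ... | inj₁ ≡ε = injective-≗ (λ x → trans (cong (x ∙_) (≡ε (θ x))) (identityʳ x)) id
  ... | inj₂ ≡x = injective-≗ (λ x → cong (x ∙_) (≡x (θ x))) id∙θ-injective

  label : ∀ {n} → (Fin (suc n) → A) → Fin n → A
  label u i = u (suc i) ∙ alternate (toℕ i) (θ (u zero)) ⁻¹

  sum-label : ∀ {n} (u : Fin (suc n) → A) →
              sum u ≡ sum (label u) ∙ (u zero ∙ alternatingθ n (u zero))
  sum-label {n} u = begin
    u zero ∙ sum (u ∘ suc)
      ≡⟨ cong (u zero ∙_) (sum-cong-≗ λ i →
           //-rightDividesˡ (alternate (toℕ i) (θ (u zero))) (u (suc i))) ⟨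
    u zero ∙ ∑[ i < n ] (label u i ∙ alternate (toℕ i) (θ (u zero)))
      ≡⟨ cong (u zero ∙_) (∑-distrib-+ (label u) _) ⟩
    u zero ∙ (sum (label u) ∙ alternatingθ n (u zero))
      ≡⟨ x∙yz≈y∙xz _ _ _ ⟩
    sum (label u) ∙ (u zero ∙ alternatingθ n (u zero)) ∎

  label-determines : ∀ {n} {u u′ : Fin (suc n) → A} →
                     label u ≗ label u′ → u zero ≡ u′ zero → u ≗ u′
  label-determines labels≡ heads≡ zero = heads≡
  label-determines {u′ = u′} labels≡ heads≡ (suc i) = ∙-cancelʳ _ _ _
    (trans (labels≡ i) (cong (λ h → u′ (suc i) ∙ alternate (toℕ i) (θ h) ⁻¹) (sym heads≡)))

  label-isAugmenting : ∀ {n} → IsAugmentingLabel (zeroSumWord {n}) label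
  label-isAugmenting {n} zero u u′ col≡ labels≡ =
    label-determines labels≡ (id∙alternatingθ-injective n (∙-cancelˡ _ _ _ (begin
      sum (label u) ∙ (u zero ∙ alternatingθ n (u zero))    ≡⟨ sum-label u ⟨
      sum u                                                 ≡⟨ ⁻¹-injective col≡ ⟩
      sum u′                                                ≡⟨ sum-label u′ ⟩
      sum (label u′) ∙ (u′ zero ∙ alternatingθ n (u′ zero)) ≡⟨ cong (_∙ _) (sum-cong-≗ labels≡) ⟨
      sum (label u) ∙ (u′ zero ∙ alternatingθ n (u′ zero))  ∎)))
  label-isAugmenting (suc zero) u u′ col≡ labels≡ = label-determines labels≡ col≡
  label-isAugmenting (suc (suc i)) u u′ col≡ labels≡ =
    label-determines labels≡ (θ-injective (alternate-injective (toℕ i) (⁻¹-injective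
      (∙-cancelˡ _ _ _
        (trans (labels≡ i) (cong (_∙ alternate (toℕ i) (θ (u′ zero)) ⁻¹) (sym col≡)))))))

aoa : ∀ {v} → CompleteMapping (Fin v) → ∀ n → AOA 1 (suc n) (suc (suc n)) v
aoa M n = aoa-fromCode zeroSumWord label zeroSumWord-isMDS label-isAugmenting
  where open ZeroSumCode M

-- Cyclic groups and the existence of complete mappings

[m%n+k]%n≡[m+k]%n : ∀ m k n .{{_ : NonZero n}} → (m % n + k) % n ≡ (m + k) % n
[m%n+k]%n≡[m+k]%n m k n = begin
  (m % n + k) % n          ≡⟨ %-distribˡ-+ (m % n) k n ⟩
  (m % n % n + k % n) % n  ≡⟨ cong (λ x → (x + k % n) % n) (m%n%n≡m%n m n) ⟩
  (m % n + k % n) % n      ≡⟨ %-distribˡ-+ m k n ⟨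
  (m + k) % n              ∎

[m*[k%n]]%n≡[m*k]%n : ∀ m k n .{{_ : NonZero n}} → (m * (k % n)) % n ≡ (m * k) % n
[m*[k%n]]%n≡[m*k]%n m k n = begin
  (m * (k % n)) % n          ≡⟨ %-distribˡ-* m (k % n) n ⟩
  (m % n * (k % n % n)) % n  ≡⟨ cong (λ x → (m % n * x) % n) (m%n%n≡m%n k n) ⟩
  (m % n * (k % n)) % n      ≡⟨ %-distribˡ-* m k n ⟨
  (m * k) % n                ∎

module Cyclic (j : ℕ) where

  [_] : ℕ → Fin (suc j)
  [ x ] = x mod suc j

  toℕ-[] : ∀ x → toℕ [ x ] ≡ x % suc j
  toℕ-[] x = toℕ-fromℕ< _

  []-cong : ∀ {x y} → x % suc j ≡ y % suc j → [ x ] ≡ [ y ]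
  []-cong {x} {y} eq = toℕ-injective (trans (toℕ-[] x) (trans eq (sym (toℕ-[] y))))

  [toℕ] : ∀ a → [ toℕ a ] ≡ a
  [toℕ] a = toℕ-injective (trans (toℕ-[] (toℕ a)) (m<n⇒m%n≡m (toℕ<n a)))

  [[x]+y] : ∀ x y → [ toℕ [ x ] + y ] ≡ [ x + y ]
  [[x]+y] x y = []-cong {toℕ [ x ] + y} {x + y}
    (trans (cong (λ z → (z + y) % suc j) (toℕ-[] x)) ([m%n+k]%n≡[m+k]%n x y (suc j)))

  [x+[y]] : ∀ x y → [ x + toℕ [ y ] ] ≡ [ x + y ]
  [x+[y]] x y = trans (cong [_] (+-comm x _)) (trans ([[x]+y] y x) (cong [_] (+-comm y x)))

  infixl 6 _+ₘ_
  _+ₘ_ : Fin (suc j) → Fin (suc j) → Fin (suc j)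
  a +ₘ b = [ toℕ a + toℕ b ]

  -ₘ_ : Fin (suc j) → Fin (suc j)
  -ₘ a = [ suc j ∸ toℕ a ]

  +ₘ-assoc : ∀ a b c → (a +ₘ b) +ₘ c ≡ a +ₘ (b +ₘ c)
  +ₘ-assoc a b c = begin
    [ toℕ [ toℕ a + toℕ b ] + toℕ c ] ≡⟨ [[x]+y] (toℕ a + toℕ b) (toℕ c) ⟩
    [ toℕ a + toℕ b + toℕ c ]         ≡⟨ cong [_] (+-assoc (toℕ a) (toℕ b) (toℕ c)) ⟩
    [ toℕ a + (toℕ b + toℕ c) ]       ≡⟨ [x+[y]] (toℕ a) (toℕ b + toℕ c) ⟨
    [ toℕ a + toℕ [ toℕ b + toℕ c ] ] ∎

  +ₘ-comm : ∀ a b → a +ₘ b ≡ b +ₘ a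
  +ₘ-comm a b = cong [_] (+-comm (toℕ a) (toℕ b))

  +ₘ-inverseˡ : ∀ a → -ₘ a +ₘ a ≡ zero
  +ₘ-inverseˡ a = begin
    [ toℕ [ suc j ∸ toℕ a ] + toℕ a ] ≡⟨ [[x]+y] (suc j ∸ toℕ a) (toℕ a) ⟩
    [ suc j ∸ toℕ a + toℕ a ]         ≡⟨ cong [_] (m∸n+n≡m (<⇒≤ (toℕ<n a))) ⟩
    [ suc j ]                         ≡⟨ []-cong {suc j} {0} (n%n≡0 (suc j)) ⟩
    [ 0 ]                             ≡⟨ [toℕ] zero ⟩
    zero                              ∎

cyclic : ∀ j → AbelianGroupOn (Fin (suc j))
cyclic j = record
  { _∙_ = _+ₘ_
  ; ε   = zero
  ; _⁻¹ = -ₘ_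
  ; isAbelianGroup = record
    { isGroup = record
      { isMonoid = record
        { isSemigroup = record
          { isMagma = record { isEquivalence = isEquivalence ; ∙-cong = cong₂ _+ₘ_ }
          ; assoc = +ₘ-assoc
          }
        ; identity = comm∧idˡ⇒id +ₘ-comm [toℕ]
        }
      ; inverse = comm∧invˡ⇒inv +ₘ-comm +ₘ-inverseˡ
      ; ⁻¹-cong = cong -ₘ_
      }
    ; comm = +ₘ-comm
    }
  }
  where open Cyclic j

module OddCyclic (j : ℕ) where
  open Cyclic (j * 2)

  m : ℕ
  m = suc (j * 2)

  halve : ∀ x → (suc j * ((x + x) % m)) % m ≡ x % m
  halve x = begin
    (suc j * ((x + x) % m)) % m  ≡⟨ [m*[k%n]]%n≡[m*k]%n (suc j) (x + x) m ⟩
    (suc j * (x + x)) % m        ≡⟨ cong (_% m) (halving j x) ⟩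
    (x + x * m) % m              ≡⟨ [m+kn]%n≡m%n x x m ⟩
    x % m                        ∎
    where
    halving : ∀ j x → suc j * (x + x) ≡ x + x * suc (j * 2)
    halving = solve-∀

  doubling-injective : Injective _≡_ _≡_ (λ a → a +ₘ a)
  doubling-injective {a} {b} eq = toℕ-injective (begin
    toℕ a                                ≡⟨ m<n⇒m%n≡m (toℕ<n a) ⟨
    toℕ a % m                            ≡⟨ halve (toℕ a) ⟨
    (suc j * ((toℕ a + toℕ a) % m)) % m  ≡⟨ cong (λ z → (suc j * z) % m) doubles≡ ⟩
    (suc j * ((toℕ b + toℕ b) % m)) % m  ≡⟨ halve (toℕ b) ⟩
    toℕ b % m                            ≡⟨ m<n⇒m%n≡m (toℕ<n b) ⟩
    toℕ b                                ∎)
    where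
    doubles≡ : (toℕ a + toℕ a) % m ≡ (toℕ b + toℕ b) % m
    doubles≡ = trans (sym (toℕ-[] (toℕ a + toℕ a))) (trans (cong toℕ eq) (toℕ-[] (toℕ b + toℕ b)))

oddCompleteMapping : ∀ j → CompleteMapping (Fin (suc (j * 2)))
oddCompleteMapping j = record
  { group = cyclic (j * 2)
  ; θ = id
  ; θ-injective = id
  ; id∙θ-injective = doubling-injective
  }
  where open OddCyclic j

ℤ₂ : AbelianGroupOn (Fin 2)
ℤ₂ = cyclic 1

ℤ₂² : AbelianGroupOn (Fin 4)
ℤ₂² = transportᴳ *↔× (ℤ₂ ×ᴳ ℤ₂)

ℤ₂³ : AbelianGroupOn (Fin 8)
ℤ₂³ = transportᴳ *↔× (ℤ₂ ×ᴳ ℤ₂²)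

-- θ is multiplication by a primitive element of GF(4), resp. GF(8), on its additive group;
-- then x ∙ θ x is multiplication by another nonzero element.
completeMapping₄ : CompleteMapping (Fin 4)
completeMapping₄ = record
  { group = ℤ₂²
  ; θ = θ
  ; θ-injective = from-yes (injective? θ)
  ; id∙θ-injective = from-yes (injective? (λ x → x ∙ θ x))
  }
  where
  open AbelianGroupOn ℤ₂² using (_∙_)
  θ : Fin 4 → Fin 4
  θ = # 0 ∷ # 2 ∷ # 3 ∷ # 1 ∷ []

completeMapping₈ : CompleteMapping (Fin 8)
completeMapping₈ = record
  { group = ℤ₂³
  ; θ = θ
  ; θ-injective = from-yes (injective? θ)
  ; id∙θ-injective = from-yes (injective? (λ x → x ∙ θ x))
  }
  where
  open AbelianGroupOn ℤ₂³ using (_∙_)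
  θ : Fin 8 → Fin 8
  θ = # 0 ∷ # 2 ∷ # 4 ∷ # 6 ∷ # 3 ∷ # 1 ∷ # 7 ∷ # 5 ∷ []

data Mod4 : ℕ → Set where
  multipleOf4 : ∀ q → Mod4 (q * 4)
  odd         : ∀ j → Mod4 (suc (j * 2))
  twiceOdd    : ∀ q → Mod4 (2 + q * 4)

mod4 : ∀ v → Mod4 v
mod4 0 = multipleOf4 0
mod4 1 = odd 0
mod4 2 = twiceOdd 0
mod4 3 = odd 1
mod4 (suc (suc (suc (suc v)))) with mod4 v
... | multipleOf4 q = multipleOf4 (suc q)
... | odd j         = odd (suc (suc j))
... | twiceOdd q    = twiceOdd (suc q)

completeMapping-×4 : ∀ q → 1 ≤ q → CompleteMapping (Fin (q * 4))
completeMapping-×4 = <-rec _ step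
  where
  step : ∀ q → (∀ {q′} → q′ < q → 1 ≤ q′ → CompleteMapping (Fin (q′ * 4))) →
         1 ≤ q → CompleteMapping (Fin (q * 4))
  step q rec 1≤q with mod4 q
  step .(0 * 4)       rec () | multipleOf4 zero
  step .(suc q * 4)   rec _  | multipleOf4 (suc q) =
    rec (m<m*n (suc q) 4 (s≤s (s≤s z≤n))) (s≤s z≤n) ⊗ completeMapping₄
  step .(suc (j * 2)) rec _  | odd j = oddCompleteMapping j ⊗ completeMapping₄
  step .(2 + q * 4)   rec _  | twiceOdd q =
    subst (CompleteMapping ∘ Fin) (eightOdd q) (oddCompleteMapping q ⊗ completeMapping₈)
    where
    eightOdd : ∀ q → suc (q * 2) * 8 ≡ (2 + q * 4) * 4
    eightOdd = solve-∀

completeMapping : ∀ v → 1 ≤ v → v % 4 ≢ 2 → CompleteMapping (Fin v)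
completeMapping v 1≤v v%4≢2 with mod4 v
completeMapping .(0 * 4)       () _      | multipleOf4 zero
completeMapping .(suc q * 4)   _  _      | multipleOf4 (suc q) =
  completeMapping-×4 (suc q) (s≤s z≤n)
completeMapping .(suc (j * 2)) _  _      | odd j      = oddCompleteMapping j
completeMapping .(2 + q * 4)   _  v%4≢2 | twiceOdd q = contradiction ([m+kn]%n≡m%n 2 q 4) v%4≢2

theorem2p3 : (v k : ℕ) → 1 ≤ v → 3 ≤ k → v % 4 ≢ 2 → AOA 1 (k ∸ 1) k v
theorem2p3 v (suc (suc n)) 1≤v _ v%4≢2 = aoa (completeMapping v 1≤v v%4≢2) n
theorem2p3 v 0 _ () _
theorem2p3 v 1 _ (s≤s ()) _
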